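{- For all $n\geq2$ and $k\geq1$, the number of non-decreasing Dyck paths with air pockets of length $n$ having exactly $k$ peaks equals $\binom{n-2}{2(k-1)}$.
   Context: A Dyck path with air pockets is a non-empty lattice path in the first quadrant starting at the origin, ending on the $x$-axis, with up-steps $U=(1,1)$ and down-steps $D_k=(1,-k)$, $k\ge1$, no two down-steps consecutive; its length is its number of steps. A peak is an occurrence of a factor $UD_m$, $m\ge1$. A valley is an occurrence of a factor $D_kU$, and its height is the ordinate of the point between $D_k$ and $U$. The path is non-decreasing if the heights of its valleys, read from left to right, form a non-decreasing sequence. -}

module Defs where

open import Data.Nat using (ℕ; zero; suc; _∸_; _≤_)
open import Data.List using (List; []; _∷_; length)
open import Data.List.Relation.Unary.Linked using (Linked)
open import Data.Unit using (⊤)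
open import Data.Empty using (⊥)
open import Data.Product using (_×_)

-- A step: U = (1,1), and D k = (1,-k)  (a valid path only uses D k with k ≥ 1).
data Step : Set where
  U : Step
  D : ℕ → Step

NoDD : List Step → Set
NoDD []                = ⊤
NoDD (U ∷ s)           = NoDD s
NoDD (D k ∷ [])        = ⊤
NoDD (D k ∷ U ∷ s)     = NoDD (U ∷ s)
NoDD (D k ∷ D m ∷ s)   = ⊥

data Ends : ℕ → List Step → Set where
  end  : Ends zero []
  up   : ∀ {h s} → Ends (suc h) s → Ends h (U ∷ s)
  down : ∀ {h k s} → 1 ≤ k → k ≤ h → Ends (h ∸ k) s → Ends h (D k ∷ s)

record IsDyckAP (p : List Step) : Set where
  field
    nonempty : 1 ≤ length p
    ends     : Ends zero p
    noDD     : NoDD p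

peaks : List Step → ℕ
peaks []              = zero
peaks (U ∷ D m ∷ s)   = suc (peaks (D m ∷ s))
peaks (U ∷ U ∷ s)     = peaks (U ∷ s)
peaks (U ∷ [])        = zero
peaks (D m ∷ s)       = peaks s

valleyHeights : ℕ → List Step → List ℕ
valleyHeights h []              = []
valleyHeights h (U ∷ s)         = valleyHeights (suc h) s
valleyHeights h (D k ∷ [])      = []
valleyHeights h (D k ∷ U ∷ s)   = (h ∸ k) ∷ valleyHeights (h ∸ k) (U ∷ s)
valleyHeights h (D k ∷ D m ∷ s) = valleyHeights (h ∸ k) (D m ∷ s)

NonDecreasing : List Step → Set
NonDecreasing p = Linked _≤_ (valleyHeights zero p)

-- A non-decreasing path splits at its valleys into runs U^(1+d+e) D_(1+e): each
-- run starts at the previous valley and ends at one that is d ≥ 0 higher, and the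
-- last run U^(1+f) D_(v+1+f) returns from the last valley v to the x-axis.  So a
-- path of length n with k peaks is a sequence (d₁, e₁, …, d_(k-1), e_(k-1), f) of
-- naturals with sum n - 2, and writing it as the binary word
-- 0^d₁ 1 0^e₁ 1 … 0^f turns it into a word of length n - 2 with 2(k-1) ones.
module Submission where

open import Defs
open import Data.Bool using (Bool; true; false)
open import Data.Empty using (⊥; ⊥-elim)
open import Data.List using (List; []; _∷_; length; map; _++_)
open import Data.List.Membership.Propositional using (_∈_)
open import Data.List.Membership.Propositional.Properties
  using (∈-map⁺; ∈-map⁻; ∈-++⁺ˡ; ∈-++⁺ʳ; ∈-++⁻)
open import Data.List.Properties using (length-map; length-++; map-∘; map-id-local; ∷-injectiveʳ)
open import Data.List.Relation.Unary.All as All using ([]; _∷_)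
open import Data.List.Relation.Unary.AllPairs using ([]; _∷_)
open import Data.List.Relation.Unary.Any using (here)
open import Data.List.Relation.Unary.Linked as Linked using (Linked; []; [-]; _∷_)
open import Data.List.Relation.Unary.Unique.Propositional using (Unique)
import Data.List.Relation.Unary.Unique.Propositional.Properties as Unique
open import Data.Nat using (ℕ; zero; suc; _+_; _*_; _∸_; _≤_; z≤n; s≤s)
open import Data.Nat.Combinatorics using (_C_; nCk+nC[k+1]≡[n+1]C[k+1])
open import Data.Nat.Properties
open import Data.Nat.Tactic.RingSolver using (solve-∀)
open import Data.Product using (Σ; _×_; _,_; proj₂; ∃-syntax)
open import Data.Sum using (inj₁; inj₂)
open import Data.Unit using (tt)
open import Function.Bundles using (_⇔_; mk⇔)
open import Relation.Binary.PropositionalEquality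
  using (_≡_; refl; sym; trans; cong; cong₂; subst; subst₂; module ≡-Reasoning)

open ≡-Reasoning

-- Binary words by length and weight

weight : List Bool → ℕ
weight []          = 0
weight (false ∷ b) = weight b
weight (true ∷ b)  = suc (weight b)

words : ℕ → ℕ → List (List Bool)
words zero    zero    = [] ∷ []
words zero    (suc j) = []
words (suc N) zero    = map (false ∷_) (words N zero)
words (suc N) (suc j) = map (false ∷_) (words N (suc j)) ++ map (true ∷_) (words N j)

length-words : ∀ N j → length (words N j) ≡ N C j
length-words zero    zero    = refl
length-words zero    (suc j) = refl
length-words (suc N) zero    = trans (length-map _ (words N zero)) (length-words N zero)
length-words (suc N) (suc j) = begin
  length (map (false ∷_) (words N (suc j)) ++ map (true ∷_) (words N j))
    ≡⟨ length-++ (map (false ∷_) (words N (suc j))) ⟩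
  length (map (false ∷_) (words N (suc j))) + length (map (true ∷_) (words N j))
    ≡⟨ cong₂ _+_ (length-map _ (words N (suc j))) (length-map _ (words N j)) ⟩
  length (words N (suc j)) + length (words N j)
    ≡⟨ cong₂ _+_ (length-words N (suc j)) (length-words N j) ⟩
  N C suc j + N C j
    ≡⟨ +-comm (N C suc j) (N C j) ⟩
  N C j + N C suc j
    ≡⟨ nCk+nC[k+1]≡[n+1]C[k+1] N j ⟩
  suc N C suc j ∎

∈-words⁻ : ∀ N j {b} → b ∈ words N j → length b ≡ N × weight b ≡ j
∈-words⁻ zero    zero    (here refl) = refl , refl
∈-words⁻ (suc N) zero    b∈ with ∈-map⁻ (false ∷_) b∈
... | b , b∈′ , refl with ∈-words⁻ N zero b∈′
...   | ℓ , w = cong suc ℓ , w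
∈-words⁻ (suc N) (suc j) b∈ with ∈-++⁻ (map (false ∷_) (words N (suc j))) b∈
... | inj₁ b∈₀ with ∈-map⁻ (false ∷_) b∈₀
...   | b , b∈′ , refl with ∈-words⁻ N (suc j) b∈′
...     | ℓ , w = cong suc ℓ , w
∈-words⁻ (suc N) (suc j) b∈ | inj₂ b∈₁ with ∈-map⁻ (true ∷_) b∈₁
...   | b , b∈′ , refl with ∈-words⁻ N j b∈′
...     | ℓ , w = cong suc ℓ , cong suc w

∈-words⁺ : ∀ b → b ∈ words (length b) (weight b)
∈-words⁺ []          = here refl
∈-words⁺ (false ∷ b) with weight b | ∈-words⁺ b
... | zero  | b∈ = ∈-map⁺ (false ∷_) b∈
... | suc j | b∈ = ∈-++⁺ˡ (∈-map⁺ (false ∷_) b∈)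
∈-words⁺ (true ∷ b)  =
  ∈-++⁺ʳ (map (false ∷_) (words (length b) (suc (weight b)))) (∈-map⁺ (true ∷_) (∈-words⁺ b))

words-unique : ∀ N j → Unique (words N j)
words-unique zero    zero    = [] ∷ []
words-unique zero    (suc j) = []
words-unique (suc N) zero    = Unique.map⁺ ∷-injectiveʳ (words-unique N zero)
words-unique (suc N) (suc j) =
  Unique.++⁺ (Unique.map⁺ ∷-injectiveʳ (words-unique N (suc j)))
             (Unique.map⁺ ∷-injectiveʳ (words-unique N j))
             disjoint
  where
  disjoint : ∀ {b} → b ∈ map (false ∷_) (words N (suc j)) × b ∈ map (true ∷_) (words N j) → ⊥
  disjoint (b∈₀ , b∈₁) with ∈-map⁻ (false ∷_) b∈₀ | ∈-map⁻ (true ∷_) b∈₁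
  ... | _ , _ , refl | _ , _ , ()

-- Segment sequences and their binary encoding

data Segments : Set where
  final   : ℕ → Segments
  segment : ℕ → ℕ → Segments → Segments

size : Segments → ℕ
size (final f)       = f
size (segment d e σ) = d + suc (e + suc (size σ))

segmentCount : Segments → ℕ
segmentCount (final f)       = zero
segmentCount (segment d e σ) = suc (segmentCount σ)

zeros : ℕ → List Bool → List Bool
zeros zero    b = b
zeros (suc x) b = false ∷ zeros x b

encode : Segments → List Bool
encode (final f)       = zeros f []
encode (segment d e σ) = zeros d (true ∷ zeros e (true ∷ encode σ))

-- decode₀ d reads the d of a segment (d zeros seen so far), decode₁ d e its e.
-- A word with an odd number of ones decodes to junk: decode₁ d e [] = final 0.
decode₀ : ℕ → List Bool → Segments
decode₁ : ℕ → ℕ → List Bool → Segments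
decode₀ d []          = final d
decode₀ d (false ∷ b) = decode₀ (suc d) b
decode₀ d (true ∷ b)  = decode₁ d 0 b
decode₁ d e []          = final 0
decode₁ d e (false ∷ b) = decode₁ d (suc e) b
decode₁ d e (true ∷ b)  = segment d e (decode₀ 0 b)

decode : List Bool → Segments
decode = decode₀ 0

length-zeros : ∀ x b → length (zeros x b) ≡ x + length b
length-zeros zero    b = refl
length-zeros (suc x) b = cong suc (length-zeros x b)

weight-zeros : ∀ x b → weight (zeros x b) ≡ weight b
weight-zeros zero    b = refl
weight-zeros (suc x) b = weight-zeros x b

zeros-suc : ∀ x b → zeros (suc x) b ≡ zeros x (false ∷ b)
zeros-suc zero    b = refl
zeros-suc (suc x) b = cong (false ∷_) (zeros-suc x b)

decode₀-zeros : ∀ d x b → decode₀ d (zeros x b) ≡ decode₀ (x + d) b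
decode₀-zeros d zero    b = refl
decode₀-zeros d (suc x) b = trans (decode₀-zeros (suc d) x b) (cong (λ d′ → decode₀ d′ b) (+-suc x d))

decode₁-zeros : ∀ d e x b → decode₁ d e (zeros x b) ≡ decode₁ d (x + e) b
decode₁-zeros d e zero    b = refl
decode₁-zeros d e (suc x) b = trans (decode₁-zeros d (suc e) x b) (cong (λ e′ → decode₁ d e′ b) (+-suc x e))

length-encode : ∀ σ → length (encode σ) ≡ size σ
length-encode (final f)       = trans (length-zeros f []) (+-identityʳ f)
length-encode (segment d e σ) = begin
  length (zeros d (true ∷ zeros e (true ∷ encode σ)))  ≡⟨ length-zeros d _ ⟩
  d + suc (length (zeros e (true ∷ encode σ)))         ≡⟨ cong (λ ℓ → d + suc ℓ) (length-zeros e _) ⟩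
  d + suc (e + suc (length (encode σ)))                ≡⟨ cong (λ ℓ → d + suc (e + suc ℓ)) (length-encode σ) ⟩
  d + suc (e + suc (size σ))                           ∎

weight-encode : ∀ σ → weight (encode σ) ≡ 2 * segmentCount σ
weight-encode (final f)       = weight-zeros f []
weight-encode (segment d e σ) = begin
  weight (zeros d (true ∷ zeros e (true ∷ encode σ)))  ≡⟨ weight-zeros d _ ⟩
  suc (weight (zeros e (true ∷ encode σ)))             ≡⟨ cong suc (weight-zeros e _) ⟩
  2 + weight (encode σ)                                ≡⟨ cong (2 +_) (weight-encode σ) ⟩
  2 + 2 * segmentCount σ                                      ≡⟨ sym (*-suc 2 (segmentCount σ)) ⟩
  2 * suc (segmentCount σ)                                    ∎

decode-encode : ∀ σ → decode (encode σ) ≡ σ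
decode-encode (final f)       = trans (decode₀-zeros 0 f []) (cong final (+-identityʳ f))
decode-encode (segment d e σ) = begin
  decode₀ 0 (zeros d (true ∷ zeros e (true ∷ encode σ)))  ≡⟨ decode₀-zeros 0 d _ ⟩
  decode₁ (d + 0) 0 (zeros e (true ∷ encode σ))           ≡⟨ decode₁-zeros (d + 0) 0 e _ ⟩
  segment (d + 0) (e + 0) (decode (encode σ))             ≡⟨ cong₂ (λ d′ e′ → segment d′ e′ (decode (encode σ))) (+-identityʳ d) (+-identityʳ e) ⟩
  segment d e (decode (encode σ))                         ≡⟨ cong (segment d e) (decode-encode σ) ⟩
  segment d e σ                                           ∎

encode-decode₀ : ∀ d b c → weight b ≡ 2 * c → encode (decode₀ d b) ≡ zeros d b
encode-decode₁ : ∀ d e b c → weight b ≡ suc (2 * c) → encode (decode₁ d e b) ≡ zeros d (true ∷ zeros e b)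
encode-decode₀ d []          c w = refl
encode-decode₀ d (false ∷ b) c w = trans (encode-decode₀ (suc d) b c w) (zeros-suc d b)
encode-decode₀ d (true ∷ b)  zero    ()
encode-decode₀ d (true ∷ b)  (suc c) w =
  encode-decode₁ d 0 b c (suc-injective (trans w (*-suc 2 c)))
encode-decode₁ d e []          c ()
encode-decode₁ d e (false ∷ b) c w =
  trans (encode-decode₁ d (suc e) b c w) (cong (λ z → zeros d (true ∷ z)) (zeros-suc e b))
encode-decode₁ d e (true ∷ b)  c w =
  cong (λ z → zeros d (true ∷ zeros e (true ∷ z))) (encode-decode₀ 0 b c (suc-injective w))

encode-decode : ∀ b c → weight b ≡ 2 * c → encode (decode b) ≡ b
encode-decode = encode-decode₀ 0

segmentsOf : ℕ → ℕ → List Segments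
segmentsOf N c = map decode (words N (2 * c))

∈-segmentsOf⁻ : ∀ N c {σ} → σ ∈ segmentsOf N c → size σ ≡ N × segmentCount σ ≡ c
∈-segmentsOf⁻ N c σ∈ with ∈-map⁻ decode σ∈
... | b , b∈ , refl with ∈-words⁻ N (2 * c) b∈
...   | ℓ , w = trans (sym (length-encode σ)) (trans (cong length (encode-decode b c w)) ℓ) ,
                *-cancelˡ-≡ _ _ 2 (trans (sym (weight-encode σ)) (trans (cong weight (encode-decode b c w)) w))
  where
  σ : Segments
  σ = decode b

∈-segmentsOf⁺ : ∀ σ → σ ∈ segmentsOf (size σ) (segmentCount σ)
∈-segmentsOf⁺ σ = subst (_∈ segmentsOf (size σ) (segmentCount σ)) (decode-encode σ)
  (∈-map⁺ decode (subst₂ (λ N j → encode σ ∈ words N j) (length-encode σ) (weight-encode σ)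
    (∈-words⁺ (encode σ))))

segmentsOf-unique : ∀ N c → Unique (segmentsOf N c)
segmentsOf-unique N c = Unique.map⁻ (subst Unique (sym encode∘decode) (words-unique N (2 * c)))
  where
  encode∘decode : map encode (segmentsOf N c) ≡ words N (2 * c)
  encode∘decode = trans (sym (map-∘ (words N (2 * c)))) (map-id-local (All.tabulate
    (λ {b} b∈ → encode-decode b c (proj₂ (∈-words⁻ N (2 * c) b∈)))))

length-segmentsOf : ∀ N c → length (segmentsOf N c) ≡ N C (2 * c)
length-segmentsOf N c = trans (length-map decode (words N (2 * c))) (length-words N (2 * c))

-- Non-decreasing paths as segment sequences

ups : ℕ → List Step → List Step
ups zero    s = s
ups (suc x) s = U ∷ ups x s

-- path v σ is the path from a valley at height v (or the origin, for v = 0):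
-- segment d e climbs 1+d+e and descends 1+e, reaching the next valley at v + d.
path : ℕ → Segments → List Step
path v (final f)       = ups (suc f) (D (v + suc f) ∷ [])
path v (segment d e σ) = ups (suc (d + e)) (D (suc e) ∷ path (v + d) σ)

length-ups : ∀ x s → length (ups x s) ≡ x + length s
length-ups zero    s = refl
length-ups (suc x) s = cong suc (length-ups x s)

ups-U : ∀ x s → ups x (U ∷ s) ≡ U ∷ ups x s
ups-U zero    s = refl
ups-U (suc x) s = cong (U ∷_) (ups-U x s)

Ends-ups : ∀ h x {s} → Ends (h + x) s → Ends h (ups x s)
Ends-ups h zero    {s} e = subst (λ h′ → Ends h′ s) (+-identityʳ h) e
Ends-ups h (suc x) {s} e = up (Ends-ups (suc h) x (subst (λ h′ → Ends h′ s) (+-suc h x) e))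

NoDD-ups : ∀ x {s} → NoDD s → NoDD (ups x s)
NoDD-ups zero    n = n
NoDD-ups (suc x) n = NoDD-ups x n

valleyHeights-ups : ∀ h x s → valleyHeights h (ups x s) ≡ valleyHeights (h + x) s
valleyHeights-ups h zero    s = cong (λ h′ → valleyHeights h′ s) (sym (+-identityʳ h))
valleyHeights-ups h (suc x) s =
  trans (valleyHeights-ups (suc h) x s) (cong (λ h′ → valleyHeights h′ s) (sym (+-suc h x)))

peaks-ups : ∀ x k s → peaks (ups (suc x) (D k ∷ s)) ≡ suc (peaks s)
peaks-ups zero    k s = refl
peaks-ups (suc x) k s = peaks-ups x k s

ups-injective : ∀ x y {k m s t} → ups x (D k ∷ s) ≡ ups y (D m ∷ t) → x ≡ y × k ≡ m × s ≡ t
ups-injective zero    zero    refl = refl , refl , refl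
ups-injective (suc x) (suc y) eq with ups-injective x y (∷-injectiveʳ eq)
... | x≡y , k≡m , s≡t = cong suc x≡y , k≡m , s≡t

NoDD-D-path : ∀ k w τ → NoDD (path w τ) → NoDD (D k ∷ path w τ)
NoDD-D-path k w (final f)       n = n
NoDD-D-path k w (segment d e τ) n = n

valleyHeights-D-path : ∀ h k w τ →
  valleyHeights h (D k ∷ path w τ) ≡ (h ∸ k) ∷ valleyHeights (h ∸ k) (path w τ)
valleyHeights-D-path h k w (final f)       = refl
valleyHeights-D-path h k w (segment d e τ) = refl

path≢[] : ∀ v σ → path v σ ≡ [] → ⊥
path≢[] v (final f)       ()
path≢[] v (segment d e σ) ()

length-path : ∀ v σ → length (path v σ) ≡ 2 + size σ
length-path v (final f)       = trans (length-ups (suc f) _) (cong suc (+-comm f 1))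
length-path v (segment d e σ) = begin
  length (ups (suc (d + e)) (D (suc e) ∷ path (v + d) σ))  ≡⟨ length-ups (suc (d + e)) _ ⟩
  suc (d + e) + suc (length (path (v + d) σ))              ≡⟨ cong (λ ℓ → suc (d + e) + suc ℓ) (length-path (v + d) σ) ⟩
  suc (d + e) + (3 + size σ)                               ≡⟨ arithmetic d e (size σ) ⟩
  2 + (d + suc (e + suc (size σ)))                         ∎
  where
  arithmetic : ∀ d e s → suc (d + e) + (3 + s) ≡ 2 + (d + suc (e + suc s))
  arithmetic = solve-∀

peaks-path : ∀ v σ → peaks (path v σ) ≡ suc (segmentCount σ)
peaks-path v (final f)       = peaks-ups f _ []
peaks-path v (segment d e σ) = trans (peaks-ups (d + e) _ _) (cong suc (peaks-path (v + d) σ))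

NoDD-path : ∀ v σ → NoDD (path v σ)
NoDD-path v (final f)       = NoDD-ups (suc f) tt
NoDD-path v (segment d e σ) = NoDD-ups (suc (d + e)) (NoDD-D-path (suc e) (v + d) σ (NoDD-path (v + d) σ))

top-of-segment : ∀ v d e → v + suc (d + e) ≡ (v + d) + suc e
top-of-segment = solve-∀

next-valley : ∀ v d e → v + suc (d + e) ∸ suc e ≡ v + d
next-valley v d e = trans (cong (_∸ suc e) (top-of-segment v d e)) (m+n∸n≡m (v + d) (suc e))

Ends-path : ∀ v σ → Ends v (path v σ)
Ends-path v (final f) =
  Ends-ups v (suc f) (down (≤-trans (s≤s z≤n) (m≤n+m (suc f) v)) ≤-refl
                           (subst (λ h → Ends h []) (sym (n∸n≡0 (v + suc f))) end))
Ends-path v (segment d e σ) =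
  Ends-ups v (suc (d + e)) (down (s≤s z≤n) e<top
    (subst (λ h → Ends h (path (v + d) σ)) (sym (next-valley v d e)) (Ends-path (v + d) σ)))
  where
  e<top : suc e ≤ v + suc (d + e)
  e<top = subst (suc e ≤_) (sym (top-of-segment v d e)) (m≤n+m (suc e) (v + d))

Linked-path : ∀ v σ → Linked _≤_ (v ∷ valleyHeights v (path v σ))
Linked-path v (final f) =
  subst (λ hs → Linked _≤_ (v ∷ hs)) (sym (valleyHeights-ups v (suc f) _)) [-]
Linked-path v (segment d e σ) =
  subst (λ hs → Linked _≤_ (v ∷ hs)) (sym heights) (m≤m+n v d ∷ Linked-path (v + d) σ)
  where
  top : ℕ
  top = v + suc (d + e)
  heights : valleyHeights v (path v (segment d e σ))
          ≡ (v + d) ∷ valleyHeights (v + d) (path (v + d) σ)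
  heights = begin
    valleyHeights v (ups (suc (d + e)) (D (suc e) ∷ path (v + d) σ))
      ≡⟨ valleyHeights-ups v (suc (d + e)) _ ⟩
    valleyHeights top (D (suc e) ∷ path (v + d) σ)
      ≡⟨ valleyHeights-D-path top (suc e) (v + d) σ ⟩
    (top ∸ suc e) ∷ valleyHeights (top ∸ suc e) (path (v + d) σ)
      ≡⟨ cong (λ w → w ∷ valleyHeights w (path (v + d) σ)) (next-valley v d e) ⟩
    (v + d) ∷ valleyHeights (v + d) (path (v + d) σ) ∎

path-injective : ∀ v {σ τ} → path v σ ≡ path v τ → σ ≡ τ
path-injective v {final f}       {final g}         eq with ups-injective (suc f) (suc g) eq
... | f≡g , _ , _ = cong final (suc-injective f≡g)
path-injective v {final f}       {segment d e τ}   eq with ups-injective (suc f) (suc (d + e)) eq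
... | _ , _ , []≡τ = ⊥-elim (path≢[] (v + d) τ (sym []≡τ))
path-injective v {segment d e σ} {final f}         eq with ups-injective (suc (d + e)) (suc f) eq
... | _ , _ , σ≡[] = ⊥-elim (path≢[] (v + d) σ σ≡[])
path-injective v {segment d e σ} {segment d′ e′ τ} eq with ups-injective (suc (d + e)) (suc (d′ + e′)) eq
... | d+e≡ , refl , σ≡τ with +-cancelʳ-≡ e d d′ (suc-injective d+e≡)
...   | refl = cong (segment d e) (path-injective (v + d) σ≡τ)

Ends-[] : ∀ {h} → Ends h [] → h ≡ 0
Ends-[] end = refl

-- The suffix r follows 1+a up-steps from the last valley v, reaching height h.
ups-path-complete : ∀ {v a h} r → v + suc a ≡ h → Ends h r → NoDD (U ∷ r) →
  Linked _≤_ (v ∷ valleyHeights h r) → ∃[ σ ] ups (suc a) r ≡ path v σ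
ups-path-complete {v} [] top e _ _ = ⊥-elim (m+1+n≢0 v (trans top (Ends-[] e)))
ups-path-complete {v} {a} (U ∷ r) top (up e) noDD L
  with ups-path-complete {v} {suc a} r (trans (+-suc v (suc a)) (cong suc top)) e noDD L
... | σ , eq = σ , trans (ups-U (suc a) r) eq
ups-path-complete {v} {a} (D k ∷ []) top (down _ k≤h e) _ _ =
  final a , cong (λ k′ → ups (suc a) (D k′ ∷ [])) (trans (≤-antisym k≤h (m∸n≡0⇒m≤n (Ends-[] e))) (sym top))
ups-path-complete (D k ∷ D m ∷ r) _ _ () _
ups-path-complete (D zero ∷ U ∷ r) _ (down () _ _) _ _
ups-path-complete {v} {a} {h} (D (suc e) ∷ U ∷ r) top (down _ k≤h (up ends)) noDD (v≤w ∷ L)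
  with ups-path-complete {h ∸ suc e} {0} r (+-comm (h ∸ suc e) 1) ends noDD L
... | τ , eq = segment d e τ ,
  cong₂ (λ a′ t → ups (suc a′) (D (suc e) ∷ t)) a≡d+e (trans eq (cong (λ w′ → path w′ τ) (sym v+d≡w)))
  where
  w d : ℕ
  w = h ∸ suc e
  d = w ∸ v
  v+d≡w : v + d ≡ w
  v+d≡w = m+[n∸m]≡n v≤w
  a≡d+e : a ≡ d + e
  a≡d+e = suc-injective (+-cancelˡ-≡ v _ _ (begin
    v + suc a            ≡⟨ top ⟩
    h                    ≡⟨ sym (m∸n+n≡m k≤h) ⟩
    w + suc e            ≡⟨ cong (_+ suc e) (sym v+d≡w) ⟩
    (v + d) + suc e      ≡⟨ sym (top-of-segment v d e) ⟩
    v + suc (d + e)      ∎))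

nonDecreasing⇒path : ∀ {p} → IsDyckAP p → NonDecreasing p → ∃[ σ ] p ≡ path 0 σ
nonDecreasing⇒path {[]}        dyck _ with IsDyckAP.nonempty dyck
... | ()
nonDecreasing⇒path {D k ∷ s}   dyck _ with IsDyckAP.ends dyck
... | down 1≤k k≤0 _ with ≤-trans 1≤k k≤0
...   | ()
nonDecreasing⇒path {U ∷ s} record { ends = up e ; noDD = noDD } L =
  ups-path-complete s refl e noDD (z≤head L)
  where
  z≤head : ∀ {hs} → Linked _≤_ hs → Linked _≤_ (0 ∷ hs)
  z≤head []      = [-]
  z≤head [-]     = z≤n ∷ [-]
  z≤head (x≤ ∷ L) = z≤n ∷ x≤ ∷ L

path-isDyckAP : ∀ σ → IsDyckAP (path 0 σ)
path-isDyckAP σ = record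
  { nonempty = subst (1 ≤_) (sym (length-path 0 σ)) (s≤s z≤n)
  ; ends     = Ends-path 0 σ
  ; noDD     = NoDD-path 0 σ
  }

path-nonDecreasing : ∀ σ → NonDecreasing (path 0 σ)
path-nonDecreasing σ = Linked.tail (Linked-path 0 σ)

theorem11 : (n k : ℕ) → 2 ≤ n → 1 ≤ k →
    Σ (List (List Step)) (λ ps →
      Unique ps ×
      ((p : List Step) →
        (p ∈ ps) ⇔ (IsDyckAP p × NonDecreasing p × length p ≡ n × peaks p ≡ k)) ×
      length ps ≡ (n ∸ 2) C (2 * (k ∸ 1)))
theorem11 (suc (suc N)) (suc c) (s≤s (s≤s z≤n)) (s≤s z≤n) =
  map (path 0) (segmentsOf N c) ,
  Unique.map⁺ (path-injective 0) (segmentsOf-unique N c) ,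
  (λ p → mk⇔ listed⇒path path⇒listed) ,
  trans (length-map (path 0) (segmentsOf N c)) (length-segmentsOf N c)
  where
  listed⇒path : ∀ {p} → p ∈ map (path 0) (segmentsOf N c) →
    IsDyckAP p × NonDecreasing p × length p ≡ 2 + N × peaks p ≡ suc c
  listed⇒path p∈ with ∈-map⁻ (path 0) p∈
  ... | σ , σ∈ , refl with ∈-segmentsOf⁻ N c σ∈
  ...   | size≡ , segmentCount≡ =
    path-isDyckAP σ , path-nonDecreasing σ ,
    trans (length-path 0 σ) (cong (2 +_) size≡) , trans (peaks-path 0 σ) (cong suc segmentCount≡)
  path⇒listed : ∀ {p} → IsDyckAP p × NonDecreasing p × length p ≡ 2 + N × peaks p ≡ suc c →
    p ∈ map (path 0) (segmentsOf N c)
  path⇒listed (dyck , nonDecreasing , length≡ , peaks≡) with nonDecreasing⇒path dyck nonDecreasing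
  ... | σ , refl =
    subst₂ (λ N′ c′ → path 0 σ ∈ map (path 0) (segmentsOf N′ c′))
      (suc-injective (suc-injective (trans (sym (length-path 0 σ)) length≡)))
      (suc-injective (trans (sym (peaks-path 0 σ)) peaks≡))
      (∈-map⁺ (path 0) (∈-segmentsOf⁺ σ))
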